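{- Let $u$ be a word with domain $\mathbb N$ over a finite alphabet. Then $\mathrm{Fac}(u)$ is well-quasi-ordered for the prefix order if and only if $u$ is ultimately periodic, and $\mathrm{Fac}(u)$ is well-quasi-ordered for the suffix order if and only if $u$ is periodic.
   Context: $\mathrm{Fac}(u)$ is the set of finite factors of $u$, i.e. the finite words $u(n)u(n+1)\cdots u(m-1)$ for $n\le m$. For finite words, $v$ is a prefix of $w$ if $w=vw'$ and a suffix of $w$ if $w=w''v$; these define the prefix and suffix orders. $u$ is periodic if there is $p>0$ with $u(i)=u(i+p)$ for all $i$, and ultimately periodic if for some $n$ the word $(u(i))_{i\ge n}$ is periodic. A poset is well-quasi-ordered if every infinite sequence has an infinite increasing subsequence. -}

module Defs where

open import Data.Nat using (ℕ; zero; suc; _+_; _∸_; _≤_; _<_)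
open import Data.List using (List; []; _∷_; _++_)
open import Data.Product using (Σ; ∃; _×_; _,_; proj₁)
open import Relation.Binary.PropositionalEquality using (_≡_)

Word : Set → Set
Word A = ℕ → A

segment : {A : Set} → Word A → ℕ → ℕ → List A
segment u n zero    = []
segment u n (suc l) = u n ∷ segment u (suc n) l

factorAt : {A : Set} → Word A → ℕ → ℕ → List A
factorAt u n m = segment u n (m ∸ n)

IsFactor : {A : Set} → Word A → List A → Set
IsFactor u w = ∃ λ n → ∃ λ m → n ≤ m × w ≡ factorAt u n m

Fac : {A : Set} → Word A → Set
Fac {A} u = Σ (List A) (IsFactor u)

_≤pre_ : {A : Set} → List A → List A → Set
v ≤pre w = ∃ λ w' → w ≡ v ++ w'

_≤suf_ : {A : Set} → List A → List A → Set
v ≤suf w = ∃ λ w'' → w ≡ w'' ++ v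

onFac : {A : Set} {u : Word A} → (List A → List A → Set) → Fac u → Fac u → Set
onFac R x y = R (proj₁ x) (proj₁ y)

WQO : (X : Set) → (X → X → Set) → Set
WQO X _≼_ = (f : ℕ → X) →
  ∃ λ (g : ℕ → ℕ) → ((i : ℕ) → g i < g (suc i)) × ((i : ℕ) → f (g i) ≼ f (g (suc i)))

Periodic : {A : Set} → Word A → Set
Periodic u = ∃ λ p → 0 < p × ((i : ℕ) → u i ≡ u (i + p))

UltimatelyPeriodic : {A : Set} → Word A → Set
UltimatelyPeriodic u = ∃ λ n → Periodic (λ i → u (n + i))

-- If u is ultimately periodic, a factor is determined by its length and by which of finitely
-- many suffixes of u it starts; so in any sequence of factors one suffix is used infinitely often,
-- and along it the lengths have a nondecreasing subsequence, which is a prefix chain. If u is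
-- periodic, factors whose end positions agree modulo the period form suffix chains in the same way.
--
-- Conversely, call a factor right special if two different letters extend it. Under the prefix
-- order, a factor and its extensions form a tree in which a right special factor is a fork; a
-- well-quasi-order forbids forks of every length, since along an increasing chain of forks the
-- branches leaving the chain form an antichain. So for some L the letter after a factor of length
-- L is determined by it, and two equal windows of length L (given by the wqo) then agree forever:
-- u is ultimately periodic. For the suffix order the same argument with left special factors shows
-- the letter before a window is determined by it. Over a finite alphabet a window of length L
-- repeats within k ^ L steps after any point, and left determinism propagates the repetition back
-- to position 0, with a period that can be taken independent of the point: u is periodic.

module Submission where

open import Defs
open import Data.Nat using (ℕ)
open import Data.Fin using (Fin)
open import Data.Product using (_×_)
open import Function.Bundles using (_⇔_)
open import Level using (0ℓ)
open import Axiom.ExcludedMiddle using (ExcludedMiddle)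

open import Axiom.DoubleNegationElimination using (em⇒dne)
open import Data.Empty using (⊥-elim)
open import Data.Fin using (toℕ; fromℕ<; funToFin; finToFun)
open import Data.Fin.Properties using (pigeonhole; toℕ≤pred[n]; toℕ-fromℕ<; finToFun-funToFin)
open import Data.List using (List; []; _∷_; _++_; length)
open import Data.List.Properties using (length-++; ++-identityʳ; ++-assoc; ∷-injective; ∷-injectiveˡ; ∷-injectiveʳ)
open import Data.Nat
open import Data.Nat.DivMod using (_%_; _/_; %-distribˡ-+; [m+kn]%n≡m%n; m%n%n≡m%n; m%n<n; m≡m%n+[m/n]*n)
open import Data.Nat.Induction using (<-rec)
open import Data.Nat.Properties
open import Data.Product using (∃; ∃₂; _,_; proj₁; proj₂)
open import Data.Sum using (inj₁; inj₂)
open import Function.Base using (_∘_)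
open import Function.Bundles using (mk⇔)
open import Relation.Nullary using (¬_; Dec; yes; no)
open import Relation.Binary.PropositionalEquality

private
  variable
    A X : Set

-- Classical facts about infinite sets of naturals

Infinite : (ℕ → Set) → Set
Infinite P = ∀ b → ∃ λ j → b ≤ j × P j

module _ (em : ExcludedMiddle 0ℓ) where

  private
    dne = em⇒dne em

  ¬Infinite⇒eventually¬ : {P : ℕ → Set} → ¬ Infinite P → ∃ λ b → ∀ j → b ≤ j → ¬ P j
  ¬Infinite⇒eventually¬ ¬inf =
    dne λ ¬ev → ¬inf λ b → dne λ ¬j → ¬ev (b , λ j b≤j pj → ¬j (j , b≤j , pj))

  infinitePigeonhole : ∀ B (c : ℕ → ℕ) → (∀ j → c j < B) → ∃ λ v → Infinite (λ j → c j ≡ v)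
  infinitePigeonhole zero    c c<0 = ⊥-elim (n≮0 (c<0 0))
  infinitePigeonhole (suc B) c c<1+B with em {Infinite (λ j → c j ≡ B)}
  ... | yes inf = B , inf
  ... | no ¬inf =
    let b , c≢B = ¬Infinite⇒eventually¬ ¬inf
        v , inf = infinitePigeonhole B (c ∘ (b +_)) λ j →
                    ≤∧≢⇒< (≤-pred (c<1+B (b + j))) (c≢B (b + j) (m≤m+n b j))
    in v , λ b′ → let j , b′≤j , cj≡v = inf b′ in b + j , ≤-trans b′≤j (m≤n+m j b) , cj≡v

  minimalBy : (key : ℕ → ℕ) {Q : ℕ → Set} → ∃ Q → ∃ λ j → Q j × (∀ j′ → Q j′ → key j ≤ key j′)
  minimalBy key {Q} (j , qj) = below (key j) j ≤-refl qj
    where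
    below : ∀ n j → key j ≤ n → Q j → ∃ λ j → Q j × (∀ j′ → Q j′ → key j ≤ key j′)
    below n j kj≤n qj with em {∃ λ j′ → Q j′ × key j′ < key j}
    ... | no none = j , qj , λ j′ qj′ → ≮⇒≥ λ lt → none (j′ , qj′ , lt)
    below zero    j kj≤0   qj | yes (_ , _ , lt) = ⊥-elim (n≮0 (<-≤-trans lt kj≤0))
    below (suc n) j kj≤1+n qj | yes (j′ , qj′ , lt) = below n j′ (≤-pred (<-≤-trans lt kj≤1+n)) qj′

  -- g (suc i) minimises the key among the indices in P beyond g i.
  monotoneSubsequence : (key : ℕ → ℕ) {P : ℕ → Set} → Infinite P →
    ∃ λ (g : ℕ → ℕ) → (∀ i → g i < g (suc i)) × (∀ i → P (g i)) × (∀ i → key (g i) ≤ key (g (suc i)))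
  monotoneSubsequence key {P} inf = g , g-inc , P∘g , key-mono
    where
    leastFrom : ∀ b → ∃ λ j → (b ≤ j × P j) × (∀ j′ → b ≤ j′ × P j′ → key j ≤ key j′)
    leastFrom b = minimalBy key (inf b)
    least : ℕ → ℕ
    least b = proj₁ (leastFrom b)
    b≤least : ∀ b → b ≤ least b
    b≤least b = proj₁ (proj₁ (proj₂ (leastFrom b)))
    from : ℕ → ℕ
    from zero    = zero
    from (suc i) = suc (least (from i))
    g : ℕ → ℕ
    g = least ∘ from
    g-inc : ∀ i → g i < g (suc i)
    g-inc i = b≤least (from (suc i))
    P∘g : ∀ i → P (g i)
    P∘g i = proj₂ (proj₁ (proj₂ (leastFrom (from i))))
    key-mono : ∀ i → key (g i) ≤ key (g (suc i))
    key-mono i = proj₂ (proj₂ (leastFrom (from i))) (g (suc i))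
      (≤-trans (b≤least (from i)) (<⇒≤ (g-inc i)) , P∘g (suc i))

  finiteColouring⇒WQO : {_≼_ : X → X → Set} (B : ℕ) (colour : X → ℕ) → (∀ x → colour x < B) →
    (size : X → ℕ) → (∀ x y → colour x ≡ colour y → size x ≤ size y → x ≼ y) → WQO X _≼_
  finiteColouring⇒WQO B colour colour<B size ≼-intro f
    with infinitePigeonhole B (colour ∘ f) (colour<B ∘ f)
  ... | v , inf with monotoneSubsequence (size ∘ f) inf
  ...   | g , g-inc , colour≡v , size-mono =
    g , g-inc , λ i → ≼-intro _ _ (trans (colour≡v i) (sym (colour≡v (suc i)))) (size-mono i)

-- Forks in tree-like orders

record Fork {X : Set} (_≼_ : X → X → Set) (size : X → ℕ) (L : ℕ) : Set where
  field
    stem left right : X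
    size-stem  : size stem ≡ L
    size-left  : size left ≡ suc L
    size-right : size right ≡ suc L
    stem≼left  : stem ≼ left
    stem≼right : stem ≼ right
    left⋠right : ¬ left ≼ right

chain⇒≼ : {_≼_ : X → X → Set} → (∀ {x} → x ≼ x) → (∀ {x y z} → x ≼ y → y ≼ z → x ≼ z) →
  (f : ℕ → X) → (∀ i → f i ≼ f (suc i)) → ∀ {i j} → i ≤ j → f i ≼ f j
chain⇒≼ {_≼_ = _≼_} ≼-refl ≼-trans f step = go ∘ ≤⇒≤′
  where
  go : ∀ {i j} → i ≤′ j → f i ≼ f j
  go ≤′-refl       = ≼-refl
  go (≤′-step i≤j) = ≼-trans (go i≤j) (step _)

module _ (em : ExcludedMiddle 0ℓ) {_≼_ : X → X → Set} (size : X → ℕ)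
  (≼-refl : ∀ {x} → x ≼ x) (≼-trans : ∀ {x y z} → x ≼ y → y ≼ z → x ≼ z)
  (≼-downwardTotal : ∀ {x y z} → x ≼ z → y ≼ z → size x ≤ size y → x ≼ y) where

  Fork-escape : ∀ {L} (φ : Fork _≼_ size L) (t : X) →
    ∃ λ e → size e ≡ suc L × Fork.stem φ ≼ e × ¬ e ≼ t
  Fork-escape {L} φ t = escape em
    where
    open Fork φ
    escape : Dec (left ≼ t) → ∃ λ e → size e ≡ suc L × stem ≼ e × ¬ e ≼ t
    escape (no left⋠t)  = left , size-left , stem≼left , left⋠t
    escape (yes left≼t) = right , size-right , stem≼right , λ right≼t →
      left⋠right (≼-downwardTotal left≼t right≼t (≤-reflexive (trans size-left (sym size-right))))

  wqo⇒¬forksOfAllSizes : WQO X _≼_ → ¬ (∀ L → Fork _≼_ size L)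
  wqo⇒¬forksOfAllSizes wqo forks = let _ , inc , rel = wqo E in E-antichain (inc 0) (rel 0)
    where
    stem : ℕ → X
    stem L = Fork.stem (forks L)
    g : ℕ → ℕ
    g = proj₁ (wqo stem)
    g-inc : ∀ i → g i < g (suc i)
    g-inc = proj₁ (proj₂ (wqo stem))
    stems≼ : ∀ {i j} → i ≤ j → stem (g i) ≼ stem (g j)
    stems≼ = chain⇒≼ {_≼_ = _≼_} ≼-refl ≼-trans (stem ∘ g) (proj₂ (proj₂ (wqo stem)))
    escape : ∀ i → ∃ λ e → size e ≡ suc (g i) × stem (g i) ≼ e × ¬ e ≼ stem (g (suc i))
    escape i = Fork-escape (forks (g i)) (stem (g (suc i)))
    E : ℕ → X
    E i = proj₁ (escape i)
    E-antichain : ∀ {i j} → i < j → ¬ E i ≼ E j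
    E-antichain {i} {j} i<j Ei≼Ej with escape i | escape j
    ... | e , size-e , _ , e⋠ | _ , _ , stem≼e′ , _ =
      e⋠ (≼-downwardTotal Ei≼Ej (≼-trans (stems≼ i<j) stem≼e′)
        (subst₂ _≤_ (sym size-e) (sym (Fork.size-stem (forks (g (suc i))))) (g-inc i)))

≤pre-refl : {x : List A} → x ≤pre x
≤pre-refl {x = x} = [] , sym (++-identityʳ x)

≤pre-trans : {x y z : List A} → x ≤pre y → y ≤pre z → x ≤pre z
≤pre-trans {x = x} (v , refl) (w , refl) = v ++ w , ++-assoc x v w

≤pre-downwardTotal : {x y z : List A} → x ≤pre z → y ≤pre z → length x ≤ length y → x ≤pre y
≤pre-downwardTotal {x = x} {y} (v , refl) (w , eq) = go x y (sym eq)
  where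
  go : ∀ x y → y ++ w ≡ x ++ v → length x ≤ length y → x ≤pre y
  go []      y       _  _         = y , refl
  go (a ∷ x) (b ∷ y) eq (s≤s x≤y) with ∷-injective eq
  ... | refl , eq′ = let r , y≡xr = go x y eq′ x≤y in r , cong (a ∷_) y≡xr

≤suf-refl : {x : List A} → x ≤suf x
≤suf-refl = [] , refl

≤suf-trans : {x y z : List A} → x ≤suf y → y ≤suf z → x ≤suf z
≤suf-trans {x = x} (v , refl) (w , refl) = w ++ v , sym (++-assoc w v x)

≤suf-downwardTotal : {x y z : List A} → x ≤suf z → y ≤suf z → length x ≤ length y → x ≤suf y
≤suf-downwardTotal {x = x} {y} (v , refl) (w , eq) = go v w (sym eq)
  where
  go : ∀ v w → w ++ y ≡ v ++ x → length x ≤ length y → x ≤suf y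
  go v       []      eq _   = v , eq
  go []      (b ∷ w) refl x≤y =
    ⊥-elim (<⇒≱ (s≤s (m≤n+m (length y) (length w))) (subst (_≤ length y) (length-++ (b ∷ w)) x≤y))
  go (a ∷ v) (b ∷ w) eq x≤y = go v w (proj₂ (∷-injective eq)) x≤y

≤suf-sameLength⇒≡ : {x y : List A} → x ≤suf y → length x ≡ length y → x ≡ y
≤suf-sameLength⇒≡ ([]    , refl) _ = refl
≤suf-sameLength⇒≡ {x = x} (a ∷ v , refl) eq =
  ⊥-elim (m≢1+n+m (length x) (trans eq (cong suc (length-++ v))))

Agree : Word A → ℕ → ℕ → ℕ → Set
Agree u l x y = ∀ i → i < l → u (x + i) ≡ u (y + i)

factor : (u : Word A) → ℕ → ℕ → Fac u
factor u n l = segment u n l , n , n + l , m≤m+n n l , cong (segment u n) (sym (m+n∸m≡n n l))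

module _ (u : Word A) where

  Agree-head : ∀ {l x y} → Agree u (suc l) x y → u x ≡ u y
  Agree-head {x = x} {y} agree = subst₂ (λ a b → u a ≡ u b) (+-identityʳ x) (+-identityʳ y) (agree 0 z<s)

  Agree-tail : ∀ {l x y} → Agree u (suc l) x y → Agree u l (suc x) (suc y)
  Agree-tail {x = x} {y} agree i i<l =
    subst₂ (λ a b → u a ≡ u b) (+-suc x i) (+-suc y i) (agree (suc i) (s<s i<l))

  Agree-∷ : ∀ {l x y} → u x ≡ u y → Agree u l (suc x) (suc y) → Agree u (suc l) x y
  Agree-∷ {x = x} {y} head tail zero    _         =
    subst₂ (λ a b → u a ≡ u b) (sym (+-identityʳ x)) (sym (+-identityʳ y)) head
  Agree-∷ {x = x} {y} head tail (suc i) (s<s i<l) =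
    subst₂ (λ a b → u a ≡ u b) (sym (+-suc x i)) (sym (+-suc y i)) (tail i i<l)

  Agree-shorten : ∀ {l l′ x y} → l ≤ l′ → Agree u l′ x y → Agree u l x y
  Agree-shorten l≤l′ agree i i<l = agree i (<-≤-trans i<l l≤l′)

  length-segment : ∀ n l → length (segment u n l) ≡ l
  length-segment n zero    = refl
  length-segment n (suc l) = cong suc (length-segment (suc n) l)

  segment-++ : ∀ n l l′ → segment u n (l + l′) ≡ segment u n l ++ segment u (n + l) l′
  segment-++ n zero    l′ = cong (λ m → segment u m l′) (sym (+-identityʳ n))
  segment-++ n (suc l) l′ = cong (u n ∷_)
    (trans (segment-++ (suc n) l l′) (cong (λ m → segment u (suc n) l ++ segment u m l′) (sym (+-suc n l))))

  segment-≤pre : ∀ n {l l′} → l ≤ l′ → segment u n l ≤pre segment u n l′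
  segment-≤pre n {l} l≤l′ = segment u (n + l) (_ ∸ l) ,
    trans (cong (segment u n) (sym (m+[n∸m]≡n l≤l′))) (segment-++ n l _)

  segment-cong : ∀ {l x y} → Agree u l x y → segment u x l ≡ segment u y l
  segment-cong {zero}  agree = refl
  segment-cong {suc l} agree = cong₂ _∷_ (Agree-head agree) (segment-cong (Agree-tail agree))

  segment-≤pre⇒Agree : ∀ {l m x y} → segment u x l ≤pre segment u y m → Agree u l x y
  segment-≤pre⇒Agree {zero}          _        = λ _ ()
  segment-≤pre⇒Agree {suc l} {suc m} (w , eq) =
    Agree-∷ (sym (∷-injectiveˡ eq)) (segment-≤pre⇒Agree (w , ∷-injectiveʳ eq))

  start : Fac u → ℕ
  start x = proj₁ (proj₂ x)

  size : Fac u → ℕ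
  size x = length (proj₁ x)

  Fac-segment : (x : Fac u) → proj₁ x ≡ segment u (start x) (size x)
  Fac-segment (_ , n , m , _ , refl) = cong (segment u n) (sym (length-segment n (m ∸ n)))

  size-factor : ∀ n l → size (factor u n l) ≡ l
  size-factor = length-segment

-- Prefix order: right special factors

RightDeterministic : Word A → ℕ → Set
RightDeterministic u L = ∀ x y → Agree u L x y → u (x + L) ≡ u (y + L)

RightSpecial : Word A → ℕ → Set
RightSpecial u L = ∃₂ λ a b → Agree u L a b × ¬ u (a + L) ≡ u (b + L)

module _ (u : Word A) where

  rightDeterministic⇒agreeForever : ∀ {L x y} → RightDeterministic u L → Agree u L x y →
    ∀ i → u (x + i) ≡ u (y + i)
  -- Strong induction: the letter at position i ≥ L follows the window of length L at i ∸ L.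
  rightDeterministic⇒agreeForever {L} {x} {y} det agree = <-rec _ step
    where
    step : ∀ i → (∀ {j} → j < i → u (x + j) ≡ u (y + j)) → u (x + i) ≡ u (y + i)
    step i rec with i <? L
    ... | yes i<L = agree i i<L
    ... | no  i≮L = subst (λ k → u (x + k) ≡ u (y + k)) (m∸n+n≡m (≮⇒≥ i≮L))
        (subst₂ (λ a b → u a ≡ u b) (+-assoc x j L) (+-assoc y j L) (det (x + j) (y + j) earlier))
      where
      j = i ∸ L
      earlier : Agree u L (x + j) (y + j)
      earlier k k<L = subst₂ (λ a b → u a ≡ u b) (sym (+-assoc x j k)) (sym (+-assoc y j k))
        (rec (subst (j + k <_) (m∸n+n≡m (≮⇒≥ i≮L)) (+-monoʳ-< j k<L)))

  rightDeterministic⇒ultimatelyPeriodic : ∀ {L a b} → RightDeterministic u L → a < b → Agree u L a b →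
    UltimatelyPeriodic u
  rightDeterministic⇒ultimatelyPeriodic {a = a} {b} det a<b agree =
    a , b ∸ a , m<n⇒0<n∸m a<b , λ i → trans (rightDeterministic⇒agreeForever det agree i) (cong u (begin
      b + i             ≡⟨ cong (_+ i) (m+[n∸m]≡n (<⇒≤ a<b)) ⟨
      a + (b ∸ a) + i   ≡⟨ +-assoc a (b ∸ a) i ⟩
      a + (b ∸ a + i)   ≡⟨ cong (a +_) (+-comm (b ∸ a) i) ⟩
      a + (i + (b ∸ a)) ∎))
    where open ≡-Reasoning

  prefixWQO⇒repeatedFactor : WQO (Fac u) (onFac _≤pre_) → ∀ L → ∃₂ λ a b → a < b × Agree u L a b
  prefixWQO⇒repeatedFactor wqo L =
    let g , g-inc , ≤pre-step = wqo (λ n → factor u n L) in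
    g 0 , g 1 , g-inc 0 , segment-≤pre⇒Agree u (≤pre-step 0)

  rightSpecial⇒Fork : ∀ {L} → RightSpecial u L → Fork (onFac _≤pre_) (size u) L
  rightSpecial⇒Fork {L} (a , b , agree , next≢) = record
    { stem       = factor u a L
    ; left       = factor u a (suc L)
    ; right      = factor u b (suc L)
    ; size-stem  = size-factor u a L
    ; size-left  = size-factor u a (suc L)
    ; size-right = size-factor u b (suc L)
    ; stem≼left  = segment-≤pre u a (n≤1+n L)
    ; stem≼right = subst (_≤pre segment u b (suc L)) (sym (segment-cong u agree)) (segment-≤pre u b (n≤1+n L))
    ; left⋠right = λ left≤right → next≢ (segment-≤pre⇒Agree u left≤right L (n<1+n L))
    }

module _ (em : ExcludedMiddle 0ℓ) (u : Word A) where

  ¬rightDeterministic⇒rightSpecial : ∀ {L} → ¬ RightDeterministic u L → RightSpecial u L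
  ¬rightDeterministic⇒rightSpecial ¬det =
    em⇒dne em λ ¬special → ¬det λ x y agree → em⇒dne em λ next≢ → ¬special (x , y , agree , next≢)

  prefixWQO⇒ultimatelyPeriodic : WQO (Fac u) (onFac _≤pre_) → UltimatelyPeriodic u
  prefixWQO⇒ultimatelyPeriodic wqo with em {∃ (RightDeterministic u)}
  ... | yes (L , det) =
    let a , b , a<b , agree = prefixWQO⇒repeatedFactor u wqo L in
    rightDeterministic⇒ultimatelyPeriodic u det a<b agree
  ... | no ¬det = ⊥-elim (wqo⇒¬forksOfAllSizes em (size u) ≤pre-refl ≤pre-trans ≤pre-downwardTotal wqo
                    λ L → rightSpecial⇒Fork u (¬rightDeterministic⇒rightSpecial (λ det → ¬det (L , det))))

-- Suffix order: left special factors

LeftDeterministic : Word A → ℕ → Set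
LeftDeterministic u L = ∀ x y → Agree u L (suc x) (suc y) → u x ≡ u y

LeftSpecial : Word A → ℕ → Set
LeftSpecial u L = ∃₂ λ a b → Agree u L (suc a) (suc b) × ¬ u a ≡ u b

module _ (u : Word A) where

  leftDeterministic⇒periodicBelow : ∀ {L a p} → LeftDeterministic u L → Agree u L a (a + p) →
    ∀ k → k < a → u k ≡ u (k + p)
  leftDeterministic⇒periodicBelow {a = suc a} {p} det agree k k<1+a with m<1+n⇒m<n∨m≡n k<1+a
  ... | inj₁ k<a  = leftDeterministic⇒periodicBelow det
                      (Agree-shorten u (n≤1+n _) (Agree-∷ u (det a (a + p) agree) agree)) k k<a
  ... | inj₂ refl = det a (a + p) agree

  leftSpecial⇒Fork : ∀ {L} → LeftSpecial u L → Fork (onFac _≤suf_) (size u) L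
  leftSpecial⇒Fork {L} (a , b , agree , letter≢) = record
    { stem       = factor u (suc a) L
    ; left       = factor u a (suc L)
    ; right      = factor u b (suc L)
    ; size-stem  = size-factor u (suc a) L
    ; size-left  = size-factor u a (suc L)
    ; size-right = size-factor u b (suc L)
    ; stem≼left  = u a ∷ [] , refl
    ; stem≼right = u b ∷ [] , cong (u b ∷_) (sym (segment-cong u agree))
    ; left⋠right = λ left≤right → letter≢ (∷-injectiveˡ (≤suf-sameLength⇒≡ left≤right
        (trans (length-segment u a (suc L)) (sym (length-segment u b (suc L))))))
    }

window : ∀ {k} → Word (Fin k) → (L : ℕ) → ℕ → Fin (k ^ L)
window u L x = funToFin {L} (λ t → u (x + toℕ t))

window-injective : ∀ {k} (u : Word (Fin k)) L {x y} → window u L x ≡ window u L y → Agree u L x y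
window-injective u L {x} {y} same t t<L = begin
  u (x + t)                     ≡⟨ cong (λ s → u (x + s)) (toℕ-fromℕ< t<L) ⟨
  u (x + toℕ τ)                 ≡⟨ finToFun-funToFin (λ s → u (x + toℕ s)) τ ⟨
  finToFun (window u L x) τ     ≡⟨ cong (λ c → finToFun c τ) same ⟩
  finToFun (window u L y) τ     ≡⟨ finToFun-funToFin (λ s → u (y + toℕ s)) τ ⟩
  u (y + toℕ τ)                 ≡⟨ cong (λ s → u (y + s)) (toℕ-fromℕ< t<L) ⟩
  u (y + t)                     ∎
  where
  open ≡-Reasoning
  τ = fromℕ< t<L

repeatedFactorAfter : ∀ {k} (u : Word (Fin k)) L N →
  ∃₂ λ a p → N ≤ a × 0 < p × p ≤ k ^ L × Agree u L a (a + p)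
repeatedFactorAfter {k} u L N with pigeonhole (n<1+n (k ^ L)) (window u L ∘ (N +_) ∘ toℕ)
... | i , j , i<j , same = N + toℕ i , toℕ j ∸ toℕ i , m≤m+n N (toℕ i) , m<n⇒0<n∸m i<j ,
  ≤-trans (m∸n≤m (toℕ j) (toℕ i)) (toℕ≤pred[n] j) ,
  subst (Agree u L (N + toℕ i)) N+j≡N+i+[j∸i] (window-injective u L same)
  where
  N+j≡N+i+[j∸i] : N + toℕ j ≡ N + toℕ i + (toℕ j ∸ toℕ i)
  N+j≡N+i+[j∸i] = trans (cong (N +_) (sym (m+[n∸m]≡n (<⇒≤ i<j)))) (sym (+-assoc N (toℕ i) _))

module _ (em : ExcludedMiddle 0ℓ) {k : ℕ} (u : Word (Fin k)) where

  leftDeterministic⇒boundedPeriodBelow : ∀ {L} → LeftDeterministic u L → ∀ N →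
    ∃ λ p → 0 < p × p ≤ k ^ L × ∀ i → i < N → u i ≡ u (i + p)
  leftDeterministic⇒boundedPeriodBelow {L} det N =
    let a , p , N≤a , 0<p , p≤K , agree = repeatedFactorAfter u L N in
    p , 0<p , p≤K , λ i i<N → leftDeterministic⇒periodicBelow u det agree i (<-≤-trans i<N N≤a)

  -- The periods valid below ever larger bounds are at most k ^ L, so one of them recurs infinitely often.
  leftDeterministic⇒periodic : ∀ {L} → LeftDeterministic u L → Periodic u
  leftDeterministic⇒periodic {L} det with infinitePigeonhole em (suc (k ^ L)) period (s≤s ∘ period≤)
    where
    period : ℕ → ℕ
    period N = proj₁ (leftDeterministic⇒boundedPeriodBelow det N)
    period≤ : ∀ N → period N ≤ k ^ L
    period≤ N = proj₁ (proj₂ (proj₂ (leftDeterministic⇒boundedPeriodBelow det N)))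
  ... | v , inf = v , 0<v , periodic
    where
    0<v : 0 < v
    0<v = let N , _ , pN≡v = inf 0
              _ , 0<p , _ = leftDeterministic⇒boundedPeriodBelow det N
          in subst (0 <_) pN≡v 0<p
    periodic : ∀ i → u i ≡ u (i + v)
    periodic i = let N , i<N , pN≡v = inf (suc i)
                     _ , _ , _ , periodicBelow = leftDeterministic⇒boundedPeriodBelow det N
                 in subst (λ p → u i ≡ u (i + p)) pN≡v (periodicBelow i i<N)

  ¬leftDeterministic⇒leftSpecial : ∀ {L} → ¬ LeftDeterministic u L → LeftSpecial u L
  ¬leftDeterministic⇒leftSpecial ¬det =
    em⇒dne em λ ¬special → ¬det λ x y agree → em⇒dne em λ letter≢ → ¬special (x , y , agree , letter≢)

  suffixWQO⇒periodic : WQO (Fac u) (onFac _≤suf_) → Periodic u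
  suffixWQO⇒periodic wqo with em {∃ (LeftDeterministic u)}
  ... | yes (L , det) = leftDeterministic⇒periodic det
  ... | no ¬det = ⊥-elim (wqo⇒¬forksOfAllSizes em (size u) ≤suf-refl ≤suf-trans ≤suf-downwardTotal wqo
                    λ L → leftSpecial⇒Fork u (¬leftDeterministic⇒leftSpecial (λ det → ¬det (L , det))))

-- Periodic words

%-cong-+ʳ : ∀ m n o d .{{_ : NonZero d}} → m % d ≡ n % d → (m + o) % d ≡ (n + o) % d
%-cong-+ʳ m n o d eq = begin
  (m + o) % d         ≡⟨ %-distribˡ-+ m o d ⟩
  (m % d + o % d) % d ≡⟨ cong (λ r → (r + o % d) % d) eq ⟩
  (n % d + o % d) % d ≡⟨ %-distribˡ-+ n o d ⟨
  (n + o) % d         ∎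
  where open ≡-Reasoning

%-cancel-+ʳ : ∀ m n o d .{{_ : NonZero d}} → (m + o) % d ≡ (n + o) % d → m % d ≡ n % d
%-cancel-+ʳ m n o (suc d) eq = begin
  m % suc d               ≡⟨ [m+kn]%n≡m%n m o (suc d) ⟨
  (m + o * suc d) % suc d ≡⟨ cong (_% suc d) (regroup m) ⟩
  (m + o + o * d) % suc d ≡⟨ %-cong-+ʳ (m + o) (n + o) (o * d) (suc d) eq ⟩
  (n + o + o * d) % suc d ≡⟨ cong (_% suc d) (regroup n) ⟨
  (n + o * suc d) % suc d ≡⟨ [m+kn]%n≡m%n n o (suc d) ⟩
  n % suc d               ∎
  where
  open ≡-Reasoning
  regroup : ∀ x → x + o * suc d ≡ x + o + o * d
  regroup x = trans (cong (x +_) (*-suc o d)) (sym (+-assoc x o (o * d)))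

module _ {v : Word A} {p : ℕ} .{{_ : NonZero p}} (periodic : ∀ i → v i ≡ v (i + p)) where

  periodic-+* : ∀ i q → v i ≡ v (i + q * p)
  periodic-+* i zero    = cong v (sym (+-identityʳ i))
  periodic-+* i (suc q) = trans (periodic-+* i q) (trans (periodic (i + q * p))
    (cong v (trans (+-assoc i (q * p) p) (cong (i +_) (+-comm (q * p) p)))))

  periodic-% : ∀ i → v i ≡ v (i % p)
  periodic-% i = trans (cong v (m≡m%n+[m/n]*n i p)) (sym (periodic-+* (i % p) (i / p)))

  periodic-cong-% : ∀ {i j} → i % p ≡ j % p → v i ≡ v j
  periodic-cong-% {i} {j} eq = trans (periodic-% i) (trans (cong v eq) (sym (periodic-% j)))

ultimatelyPeriodic⇒finitelyManySuffixes : (u : Word A) → UltimatelyPeriodic u →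
  ∃ λ B → ∀ n → ∃ λ c → c < B × ∀ i → u (n + i) ≡ u (c + i)
ultimatelyPeriodic⇒finitelyManySuffixes u (n₀ , p , 0<p , periodic) = n₀ + p , representative
  where
  instance
    p≢0 : NonZero p
    p≢0 = >-nonZero 0<p
  representative : ∀ n → ∃ λ c → c < n₀ + p × ∀ i → u (n + i) ≡ u (c + i)
  representative n with n <? n₀
  ... | yes n<n₀ = n , <-≤-trans n<n₀ (m≤m+n n₀ p) , λ i → refl
  ... | no  n≮n₀ = n₀ + d % p , +-monoʳ-< n₀ (m%n<n d p) , λ i → begin
    u (n + i)            ≡⟨ cong (λ m → u (m + i)) (m+[n∸m]≡n (≮⇒≥ n≮n₀)) ⟨
    u (n₀ + d + i)       ≡⟨ cong u (+-assoc n₀ d i) ⟩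
    u (n₀ + (d + i))     ≡⟨ periodic-cong-% periodic (%-cong-+ʳ d (d % p) i p (sym (m%n%n≡m%n d p))) ⟩
    u (n₀ + (d % p + i)) ≡⟨ cong u (+-assoc n₀ (d % p) i) ⟨
    u (n₀ + d % p + i)   ∎
    where
    open ≡-Reasoning
    d = n ∸ n₀

module _ (em : ExcludedMiddle 0ℓ) (u : Word A) where

  ultimatelyPeriodic⇒prefixWQO : UltimatelyPeriodic u → WQO (Fac u) (onFac _≤pre_)
  ultimatelyPeriodic⇒prefixWQO up with ultimatelyPeriodic⇒finitelyManySuffixes u up
  ... | B , representative = finiteColouring⇒WQO em B colour colour<B (size u) ≤pre-intro
    where
    colour : Fac u → ℕ
    colour x = proj₁ (representative (start u x))
    colour<B : ∀ x → colour x < B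
    colour<B x = proj₁ (proj₂ (representative (start u x)))
    canonical : ∀ x → proj₁ x ≡ segment u (colour x) (size u x)
    canonical x = trans (Fac-segment u x) (segment-cong u λ i _ → proj₂ (proj₂ (representative (start u x))) i)
    ≤pre-intro : ∀ x y → colour x ≡ colour y → size u x ≤ size u y → onFac _≤pre_ x y
    ≤pre-intro x y same x≤y = subst₂ _≤pre_
      (sym (trans (canonical x) (cong (λ c → segment u c (size u x)) same))) (sym (canonical y))
      (segment-≤pre u (colour y) x≤y)

  periodic⇒suffixWQO : Periodic u → WQO (Fac u) (onFac _≤suf_)
  periodic⇒suffixWQO (p , 0<p , periodic) =
    finiteColouring⇒WQO em p colour (λ x → m%n<n (end x) p) (size u) ≤suf-intro
    where
    instance
      p≢0 : NonZero p
      p≢0 = >-nonZero 0<p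
    end : Fac u → ℕ
    end x = start u x + size u x
    colour : Fac u → ℕ
    colour x = end x % p
    ≤suf-intro : ∀ x y → colour x ≡ colour y → size u x ≤ size u y → onFac _≤suf_ x y
    ≤suf-intro x y same lx≤ly = segment u sy δ , (begin
      proj₁ y                                  ≡⟨ Fac-segment u y ⟩
      segment u sy ly                          ≡⟨ cong (segment u sy) (m∸n+n≡m lx≤ly) ⟨
      segment u sy (δ + lx)                    ≡⟨ segment-++ u sy δ lx ⟩
      segment u sy δ ++ segment u (sy + δ) lx  ≡⟨ cong (segment u sy δ ++_) (segment-cong u aligned) ⟩
      segment u sy δ ++ segment u sx lx        ≡⟨ cong (segment u sy δ ++_) (Fac-segment u x) ⟨
      segment u sy δ ++ proj₁ x                ∎)
      where
      open ≡-Reasoning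
      sx = start u x
      sy = start u y
      lx = size u x
      ly = size u y
      δ = ly ∸ lx
      aligned : Agree u lx (sy + δ) sx
      aligned i _ = periodic-cong-% periodic (%-cong-+ʳ (sy + δ) sx i p (%-cancel-+ʳ (sy + δ) sx lx p (begin
        (sy + δ + lx) % p ≡⟨ cong (_% p) (trans (+-assoc sy δ lx) (cong (sy +_) (m∸n+n≡m lx≤ly))) ⟩
        (sy + ly) % p     ≡⟨ same ⟨
        (sx + lx) % p     ∎)))

mainTheorem16 : ExcludedMiddle 0ℓ → (k : ℕ) → (u : Word (Fin k)) →
    (WQO (Fac u) (onFac _≤pre_) ⇔ UltimatelyPeriodic u)
    × (WQO (Fac u) (onFac _≤suf_) ⇔ Periodic u)
mainTheorem16 em k u =
  mk⇔ (prefixWQO⇒ultimatelyPeriodic em u) (ultimatelyPeriodic⇒prefixWQO em u) ,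
  mk⇔ (suffixWQO⇒periodic em u) (periodic⇒suffixWQO em u)
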